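{- Let $\mathcal{M}$ be a matroid with rank function $r$ and let $(C_1,C_2,\dots,C_t)$ be a circuit decomposition of $\mathcal{M}$. Then $r(D_j)-r(D_{j-1})=|\tilde C_j|-1$ for all $1\le j\le t$.
   Context: For a sequence $(C_1,\dots,C_t)$ of circuits of a matroid $\mathcal{M}$ on ground set $E$, let $D_0=\emptyset$, $D_j=\bigcup_{i=1}^jC_i$, and $\tilde C_i=C_i-D_{i-1}$ (the lobe of $C_i$). The sequence is a partial circuit decomposition if for all $2\le i\le t$: (E1) $C_i-D_{i-1}\ne\emptyset$; (E2) there is no circuit $C'$ with $C'-D_{i-1}\ne\emptyset$ and $C'-D_{i-1}$ a proper subset of $C_i-D_{i-1}$. It is a circuit decomposition if additionally $D_t=E$. -}

module Defs where

open import Data.Nat using (ℕ; zero; suc; _+_; _≤_)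
open import Data.Product using (_×_)
open import Data.Fin.Subset using (Subset; _⊆_; _⊂_; _∪_; _∩_; _─_; ∣_∣; ⊥; ⊤; Nonempty)
open import Relation.Nullary using (¬_)
open import Relation.Binary.PropositionalEquality using (_≡_)

record Matroid (n : ℕ) : Set where
  field
    r          : Subset n → ℕ
    r-bounded  : ∀ X → r X ≤ ∣ X ∣
    r-mono     : ∀ {X Y} → X ⊆ Y → r X ≤ r Y
    r-submod   : ∀ X Y → r (X ∪ Y) + r (X ∩ Y) ≤ r X + r Y

module _ {n : ℕ} (M : Matroid n) where
  open Matroid M

  Independent : Subset n → Set
  Independent X = r X ≡ ∣ X ∣

  IsCircuit : Subset n → Set
  IsCircuit C = ¬ Independent C × (∀ Y → Y ⊂ C → Independent Y)

-- Sequences of circuits (C₁,…,C_t) are given as functions ℕ → Subset n,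
-- of which only indices 1..t are relevant (index 0 is ignored).
-- D C j = C₁ ∪ … ∪ C_j, with D C 0 = ∅.
D : {n : ℕ} → (ℕ → Subset n) → ℕ → Subset n
D C zero    = ⊥
D C (suc j) = D C j ∪ C (suc j)

lobe : {n : ℕ} → (ℕ → Subset n) → ℕ → Subset n
lobe C zero    = C zero ─ ⊥
lobe C (suc i) = C (suc i) ─ D C i

module _ {n : ℕ} (M : Matroid n) where

  IsPartialCircuitDecomposition : (ℕ → Subset n) → ℕ → Set
  IsPartialCircuitDecomposition C t =
      (∀ i → 1 ≤ i → i ≤ t → IsCircuit M (C i))
    × (∀ i → 1 ≤ i → suc i ≤ t → Nonempty (C (suc i) ─ D C i))
    × (∀ i → 1 ≤ i → suc i ≤ t → ∀ C′ → IsCircuit M C′ →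
         Nonempty (C′ ─ D C i) → ¬ ((C′ ─ D C i) ⊂ (C (suc i) ─ D C i)))

  IsCircuitDecomposition : (ℕ → Subset n) → ℕ → Set
  IsCircuitDecomposition C t = IsPartialCircuitDecomposition C t × D C t ≡ ⊤

{-# OPTIONS --safe #-}

-- Submodularity, together with the independence of D_{j-1} ∩ C_j (a proper
-- subset of the circuit C_j), gives r(D_j) ≤ r(D_{j-1}) + |C̃_j| − 1.
-- Conversely, let X be the lobe C̃_j with one element removed.  By (E2) no
-- circuit has its part outside D_{j-1} inside X, so a basis of D_{j-1}
-- extended by X contains no circuit and is independent; hence
-- r(D_j) ≥ r(D_{j-1} ∪ X) = r(D_{j-1}) + |C̃_j| − 1.  For j = 1 the role of
-- (E2) is played by the independence of proper subsets of the circuit C_1.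
module Submission where

open import Defs
open import Data.Nat using (ℕ; suc; _+_; _≤_; _<_; z≤n; s≤s)
open import Data.Nat.Properties
open import Data.Fin using (Fin)
open import Data.Fin.Properties using (any?)
open import Data.Fin.Subset
  using (Subset; ∣_∣; _∈_; _∉_; _⊆_; _⊂_; _∪_; _∩_; _─_; _-_; ⁅_⁆; ⊥; Nonempty; Empty; inside; outside)
open import Data.Fin.Subset.Properties
open import Data.Fin.Subset.Induction using (Acc; acc; ⊂-wellFounded)
open import Data.Vec using (_∷_; []; here; there)
open import Data.Product using (_×_; _,_; proj₁; proj₂; ∃; map)
open import Data.Sum using (inj₁; inj₂; [_,_])
open import Function using (id; _∘_)
open import Relation.Nullary using (¬_; yes; no; contradiction)
open import Relation.Nullary.Decidable using (_×-dec_; ¬?; decidable-stable)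
open import Relation.Unary using (Decidable)
open import Relation.Binary.PropositionalEquality
  using (_≡_; refl; sym; trans; cong; subst; subst₂; module ≡-Reasoning)

x∈p─q⁻ : ∀ {n} {x : Fin n} (p q : Subset n) → x ∈ p ─ q → x ∈ p × x ∉ q
x∈p─q⁻ (s ∷ p) (outside ∷ q) here      = here , λ ()
x∈p─q⁻ (s ∷ p) (t ∷ q)       (there x∈) =
  map there (λ x∉q → x∉q ∘ drop-there) (x∈p─q⁻ p q x∈)

p⊆[p─q]∪s : ∀ {n} {p q s : Subset n} → q ⊆ s → p ⊆ (p ─ q) ∪ s
p⊆[p─q]∪s {q = q} q⊆s {x} x∈p with x ∈? q
... | yes x∈q = x∈p∪q⁺ (inj₂ (q⊆s x∈q))
... | no  x∉q = x∈p∪q⁺ (inj₁ (x∈p∧x∉q⇒x∈p─q x∈p x∉q))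

∪-mono-⊆ : ∀ {n} {p q s u : Subset n} → p ⊆ q → s ⊆ u → p ∪ s ⊆ q ∪ u
∪-mono-⊆ {p = p} {s = s} p⊆q s⊆u x∈p∪s =
  [ x∈p∪q⁺ ∘ inj₁ ∘ p⊆q , x∈p∪q⁺ ∘ inj₂ ∘ s⊆u ] (x∈p∪q⁻ p s x∈p∪s)

Empty⇒∣p∣≡0 : ∀ {n} {p : Subset n} → Empty p → ∣ p ∣ ≡ 0
Empty⇒∣p∣≡0 {n} empty = trans (cong ∣_∣ (Empty-unique empty)) (∣⊥∣≡0 n)

∣p∩q∣+∣q─p∣≡∣q∣ : ∀ {n} (p q : Subset n) → ∣ p ∩ q ∣ + ∣ q ─ p ∣ ≡ ∣ q ∣
∣p∩q∣+∣q─p∣≡∣q∣ []            []            = refl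
∣p∩q∣+∣q─p∣≡∣q∣ (inside ∷ p)  (inside ∷ q)  = cong suc (∣p∩q∣+∣q─p∣≡∣q∣ p q)
∣p∩q∣+∣q─p∣≡∣q∣ (inside ∷ p)  (outside ∷ q) = ∣p∩q∣+∣q─p∣≡∣q∣ p q
∣p∩q∣+∣q─p∣≡∣q∣ (outside ∷ p) (inside ∷ q)  =
  trans (+-suc ∣ p ∩ q ∣ ∣ q ─ p ∣) (cong suc (∣p∩q∣+∣q─p∣≡∣q∣ p q))
∣p∩q∣+∣q─p∣≡∣q∣ (outside ∷ p) (outside ∷ q) = ∣p∩q∣+∣q─p∣≡∣q∣ p q

∣p∪q∣+∣p∩q∣≡∣p∣+∣q∣ : ∀ {n} (p q : Subset n) → ∣ p ∪ q ∣ + ∣ p ∩ q ∣ ≡ ∣ p ∣ + ∣ q ∣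
∣p∪q∣+∣p∩q∣≡∣p∣+∣q∣ []            []            = refl
∣p∪q∣+∣p∩q∣≡∣p∣+∣q∣ (inside ∷ p)  (inside ∷ q)  = cong suc (begin
  ∣ p ∪ q ∣ + suc ∣ p ∩ q ∣   ≡⟨ +-suc ∣ p ∪ q ∣ ∣ p ∩ q ∣ ⟩
  suc (∣ p ∪ q ∣ + ∣ p ∩ q ∣) ≡⟨ cong suc (∣p∪q∣+∣p∩q∣≡∣p∣+∣q∣ p q) ⟩
  suc (∣ p ∣ + ∣ q ∣)         ≡⟨ +-suc ∣ p ∣ ∣ q ∣ ⟨
  ∣ p ∣ + suc ∣ q ∣           ∎)
  where open ≡-Reasoning
∣p∪q∣+∣p∩q∣≡∣p∣+∣q∣ (inside ∷ p)  (outside ∷ q) = cong suc (∣p∪q∣+∣p∩q∣≡∣p∣+∣q∣ p q)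
∣p∪q∣+∣p∩q∣≡∣p∣+∣q∣ (outside ∷ p) (inside ∷ q)  =
  trans (cong suc (∣p∪q∣+∣p∩q∣≡∣p∣+∣q∣ p q)) (sym (+-suc ∣ p ∣ ∣ q ∣))
∣p∪q∣+∣p∩q∣≡∣p∣+∣q∣ (outside ∷ p) (outside ∷ q) = ∣p∪q∣+∣p∩q∣≡∣p∣+∣q∣ p q

∣p∣≤suc∣p-x∣ : ∀ {n} (p : Subset n) (x : Fin n) → ∣ p ∣ ≤ suc ∣ p - x ∣
∣p∣≤suc∣p-x∣ p x = begin
  ∣ p ∣                   ≡⟨ ∣p∩q∣+∣q─p∣≡∣q∣ ⁅ x ⁆ p ⟨
  ∣ ⁅ x ⁆ ∩ p ∣ + ∣ p - x ∣ ≤⟨ +-monoˡ-≤ ∣ p - x ∣ (∣p∩q∣≤∣p∣ ⁅ x ⁆ p) ⟩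
  ∣ ⁅ x ⁆ ∣ + ∣ p - x ∣     ≡⟨ cong (_+ ∣ p - x ∣) (∣⁅x⁆∣≡1 x) ⟩
  suc ∣ p - x ∣           ∎
  where open ≤-Reasoning

module _ {n : ℕ} (M : Matroid n) where
  open Matroid M
  open ≤-Reasoning

  independent? : Decidable (Independent M)
  independent? X = r X ≟ ∣ X ∣

  dependent⇒r<∣∣ : ∀ {X} → ¬ Independent M X → r X < ∣ X ∣
  dependent⇒r<∣∣ {X} = ≤∧≢⇒< (r-bounded X)

  r-subadditive : ∀ X Y → r (X ∪ Y) ≤ r X + r Y
  r-subadditive X Y = m+n≤o⇒m≤o (r (X ∪ Y)) (r-submod X Y)

  independent-⊆ : ∀ {X Y} → X ⊆ Y → Independent M Y → Independent M X
  independent-⊆ {X} {Y} X⊆Y indY =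
    ≤-antisym (r-bounded X) (+-cancelʳ-≤ ∣ Y ─ X ∣ ∣ X ∣ (r X) (begin
      ∣ X ∣ + ∣ Y ─ X ∣      ≤⟨ +-monoˡ-≤ ∣ Y ─ X ∣ (p⊆q⇒∣p∣≤∣q∣ (λ x∈X → x∈p∩q⁺ (x∈X , X⊆Y x∈X))) ⟩
      ∣ X ∩ Y ∣ + ∣ Y ─ X ∣  ≡⟨ ∣p∩q∣+∣q─p∣≡∣q∣ X Y ⟩
      ∣ Y ∣                  ≡⟨ indY ⟨
      r Y                    ≤⟨ r-mono (p⊆[p─q]∪s id) ⟩
      r ((Y ─ X) ∪ X)        ≤⟨ r-subadditive (Y ─ X) X ⟩
      r (Y ─ X) + r X        ≤⟨ +-monoˡ-≤ (r X) (r-bounded (Y ─ X)) ⟩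
      ∣ Y ─ X ∣ + r X        ≡⟨ +-comm ∣ Y ─ X ∣ (r X) ⟩
      r X + ∣ Y ─ X ∣        ∎))

  dependent⇒∃circuit : ∀ {Z} → ¬ Independent M Z → ∃ λ C → C ⊆ Z × IsCircuit M C
  dependent⇒∃circuit {Z} = go Z (⊂-wellFounded Z)
    where
    -- If some one-point deletion of Z is still dependent, recurse into it;
    -- otherwise every proper subset of Z lies in an independent deletion.
    go : ∀ Z → Acc _⊂_ Z → ¬ Independent M Z → ∃ λ C → C ⊆ Z × IsCircuit M C
    go Z (acc smaller) dep with any? (λ z → z ∈? Z ×-dec ¬? (independent? (Z - z)))
    ... | yes (z , z∈Z , dep-z) =
      let C , C⊆Z-z , isCircuit = go (Z - z) (smaller (x∈p⇒p-x⊂p z∈Z)) dep-z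
      in C , p─q⊆p Z ⁅ z ⁆ ∘ C⊆Z-z , isCircuit
    ... | no ¬dep-z = Z , id , dep , properSubsets-independent
      where
      properSubsets-independent : ∀ Y → Y ⊂ Z → Independent M Y
      properSubsets-independent Y (Y⊆Z , z , z∈Z , z∉Y) =
        independent-⊆ (λ y∈Y → x∈p∧x≢y⇒x∈p-y (Y⊆Z y∈Y) λ { refl → z∉Y y∈Y })
          (decidable-stable (independent? (Z - z)) (λ dep-z → ¬dep-z (z , z∈Z , dep-z)))

  circuit-free⇒independent : ∀ {Y} → (∀ C → IsCircuit M C → ¬ C ⊆ Y) → Independent M Y
  circuit-free⇒independent {Y} circuit-free =
    decidable-stable (independent? Y) λ dep →
      let C , C⊆Y , isCircuit = dependent⇒∃circuit dep in circuit-free C isCircuit C⊆Y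

  circuit-nonempty : ∀ {C} → IsCircuit M C → Nonempty C
  circuit-nonempty {C} (dep , _) with nonempty? C
  ... | yes nonempty = nonempty
  ... | no  empty    = contradiction
    (≤-antisym (r-bounded C) (subst (_≤ r C) (sym (Empty⇒∣p∣≡0 empty)) z≤n)) dep

  r-circuit-delete : ∀ {C z} → IsCircuit M C → z ∈ C → r (C - z) ≡ r C
  r-circuit-delete {C} {z} (dep , minimal) z∈C =
    ≤-antisym (r-mono (p─q⊆p C ⁅ z ⁆)) (≤-pred (begin-strict
      r C               <⟨ dependent⇒r<∣∣ dep ⟩
      ∣ C ∣             ≤⟨ ∣p∣≤suc∣p-x∣ C z ⟩
      suc ∣ C - z ∣     ≡⟨ cong suc (minimal (C - z) (x∈p⇒p-x⊂p z∈C)) ⟨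
      suc (r (C - z))   ∎))

  circuit-rank : ∀ {C} → IsCircuit M C → suc (r C) ≡ ∣ C ∣
  circuit-rank {C} isCircuit@(dep , minimal) with circuit-nonempty isCircuit
  ... | z , z∈C = ≤-antisym (dependent⇒r<∣∣ dep) (begin
    ∣ C ∣             ≤⟨ ∣p∣≤suc∣p-x∣ C z ⟩
    suc ∣ C - z ∣     ≡⟨ cong suc (minimal (C - z) (x∈p⇒p-x⊂p z∈C)) ⟨
    suc (r (C - z))   ≡⟨ cong suc (r-circuit-delete isCircuit z∈C) ⟩
    suc (r C)         ∎)

  r-∪-redundant : ∀ A C → r C ≤ r (A ∩ C) → r (A ∪ C) ≤ r A
  r-∪-redundant A C rC≤r[A∩C] = +-cancelʳ-≤ (r (A ∩ C)) (r (A ∪ C)) (r A) (begin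
    r (A ∪ C) + r (A ∩ C) ≤⟨ r-submod A C ⟩
    r A + r C             ≤⟨ +-monoʳ-≤ (r A) rC≤r[A∩C] ⟩
    r A + r (A ∩ C)       ∎)

  r-delete-circuitElement : ∀ {Z C z} → C ⊆ Z → IsCircuit M C → z ∈ C → r (Z - z) ≡ r Z
  r-delete-circuitElement {Z} {C} {z} C⊆Z isCircuit z∈C =
    ≤-antisym (r-mono (p─q⊆p Z ⁅ z ⁆)) (begin
      r Z               ≤⟨ r-mono (p⊆[p─q]∪s ⁅z⁆⊆C) ⟩
      r ((Z - z) ∪ C)   ≤⟨ r-∪-redundant (Z - z) C rC≤r[Z-z∩C] ⟩
      r (Z - z)         ∎)
    where
    ⁅z⁆⊆C : ⁅ z ⁆ ⊆ C
    ⁅z⁆⊆C x∈⁅z⁆ = subst (_∈ C) (sym (x∈⁅y⁆⇒x≡y z x∈⁅z⁆)) z∈C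
    C-z⊆Z-z∩C : C - z ⊆ (Z - z) ∩ C
    C-z⊆Z-z∩C x∈C-z =
      let x∈C , x∉⁅z⁆ = x∈p─q⁻ C ⁅ z ⁆ x∈C-z
      in x∈p∩q⁺ (x∈p∧x∉q⇒x∈p─q (C⊆Z x∈C) x∉⁅z⁆ , x∈C)
    rC≤r[Z-z∩C] : r C ≤ r ((Z - z) ∩ C)
    rC≤r[Z-z∩C] = begin
      r C               ≡⟨ r-circuit-delete isCircuit z∈C ⟨
      r (C - z)         ≤⟨ r-mono C-z⊆Z-z∩C ⟩
      r ((Z - z) ∩ C)   ∎

  ∃-basis : ∀ A → ∃ λ B → B ⊆ A × Independent M B × ∣ B ∣ ≡ r A
  ∃-basis A = go A (⊂-wellFounded A)
    where
    go : ∀ A → Acc _⊂_ A → ∃ λ B → B ⊆ A × Independent M B × ∣ B ∣ ≡ r A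
    go A (acc smaller) with independent? A
    ... | yes indA = A , id , indA , sym indA
    ... | no  depA =
      let C , C⊆A , isCircuit = dependent⇒∃circuit depA
          z , z∈C = circuit-nonempty isCircuit
          B , B⊆A-z , indB , ∣B∣≡r[A-z] = go (A - z) (smaller (x∈p⇒p-x⊂p (C⊆A z∈C)))
      in B , p─q⊆p A ⁅ z ⁆ ∘ B⊆A-z , indB
           , trans ∣B∣≡r[A-z] (r-delete-circuitElement C⊆A isCircuit z∈C)

  r-∪-free : ∀ {A X} → (∀ {x} → x ∈ X → x ∉ A) →
             (∀ C → IsCircuit M C → Nonempty (C ─ A) → ¬ C ─ A ⊆ X) →
             r A + ∣ X ∣ ≤ r (A ∪ X)
  r-∪-free {A} {X} X∩A≡∅ noCircuitOutsideA⊆X with ∃-basis A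
  ... | B , B⊆A , indB , ∣B∣≡rA = begin
    r A + ∣ X ∣           ≡⟨ cong (_+ ∣ X ∣) ∣B∣≡rA ⟨
    ∣ B ∣ + ∣ X ∣         ≡⟨ ∣p∪q∣+∣p∩q∣≡∣p∣+∣q∣ B X ⟨
    ∣ B ∪ X ∣ + ∣ B ∩ X ∣ ≡⟨ cong (∣ B ∪ X ∣ +_) (Empty⇒∣p∣≡0 B∩X-empty) ⟩
    ∣ B ∪ X ∣ + 0         ≡⟨ +-identityʳ ∣ B ∪ X ∣ ⟩
    ∣ B ∪ X ∣             ≡⟨ circuit-free⇒independent circuit⊈B∪X ⟨
    r (B ∪ X)             ≤⟨ r-mono (∪-mono-⊆ B⊆A id) ⟩
    r (A ∪ X)             ∎
    where
    B∩X-empty : Empty (B ∩ X)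
    B∩X-empty (x , x∈B∩X) = let x∈B , x∈X = x∈p∩q⁻ B X x∈B∩X in X∩A≡∅ x∈X (B⊆A x∈B)

    circuit⊈B∪X : ∀ C → IsCircuit M C → ¬ C ⊆ B ∪ X
    circuit⊈B∪X C isCircuit@(dep , _) C⊆B∪X with nonempty? (C ─ A)
    ... | yes nonempty = noCircuitOutsideA⊆X C isCircuit nonempty λ x∈C─A →
      let x∈C , x∉A = x∈p─q⁻ C A x∈C─A
      in [ (λ x∈B → contradiction (B⊆A x∈B) x∉A) , id ] (x∈p∪q⁻ B X (C⊆B∪X x∈C))
    ... | no  empty = dep (independent-⊆ C⊆B indB)
      where
      C⊆B : C ⊆ B
      C⊆B {x} x∈C =
        [ id , (λ x∈X → contradiction (x , x∈p∧x∉q⇒x∈p─q x∈C (X∩A≡∅ x∈X)) empty) ]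
        (x∈p∪q⁻ B X (C⊆B∪X x∈C))

  r-∪-circuit-< : ∀ {A C} → IsCircuit M C → Nonempty (C ─ A) → r (A ∪ C) < r A + ∣ C ─ A ∣
  r-∪-circuit-< {A} {C} isCircuit@(_ , minimal) (e , e∈C─A) =
    +-cancelʳ-≤ ∣ A ∩ C ∣ (suc (r (A ∪ C))) (r A + ∣ C ─ A ∣) (begin
      suc (r (A ∪ C)) + ∣ A ∩ C ∣     ≡⟨ cong (suc (r (A ∪ C)) +_) indA∩C ⟨
      suc (r (A ∪ C) + r (A ∩ C))     ≤⟨ s≤s (r-submod A C) ⟩
      suc (r A + r C)                 ≡⟨ +-suc (r A) (r C) ⟨
      r A + suc (r C)                 ≡⟨ cong (r A +_) (circuit-rank isCircuit) ⟩
      r A + ∣ C ∣                     ≡⟨ cong (r A +_) (∣p∩q∣+∣q─p∣≡∣q∣ A C) ⟨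
      r A + (∣ A ∩ C ∣ + ∣ C ─ A ∣)   ≡⟨ cong (r A +_) (+-comm ∣ A ∩ C ∣ ∣ C ─ A ∣) ⟩
      r A + (∣ C ─ A ∣ + ∣ A ∩ C ∣)   ≡⟨ +-assoc (r A) ∣ C ─ A ∣ ∣ A ∩ C ∣ ⟨
      r A + ∣ C ─ A ∣ + ∣ A ∩ C ∣     ∎)
    where
    indA∩C : Independent M (A ∩ C)
    indA∩C with x∈p─q⁻ C A e∈C─A
    ... | e∈C , e∉A = minimal (A ∩ C) (p∩q⊆q A C , e , e∈C , e∉A ∘ proj₁ ∘ x∈p∩q⁻ A C)

  -- condition (E2) for a circuit C added after circuits covering A
  LobeMinimal : Subset n → Subset n → Set
  LobeMinimal A C = ∀ C′ → IsCircuit M C′ → Nonempty (C′ ─ A) → ¬ (C′ ─ A ⊂ C ─ A)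

  r-∪-minimalLobe-≥ : ∀ {A C} → Nonempty (C ─ A) → LobeMinimal A C →
                      r A + ∣ C ─ A ∣ ≤ suc (r (A ∪ C))
  r-∪-minimalLobe-≥ {A} {C} (e , e∈C─A) lobeMinimal = begin
    r A + ∣ C ─ A ∣        ≤⟨ +-monoʳ-≤ (r A) (∣p∣≤suc∣p-x∣ (C ─ A) e) ⟩
    r A + suc ∣ X ∣        ≡⟨ +-suc (r A) ∣ X ∣ ⟩
    suc (r A + ∣ X ∣)      ≤⟨ s≤s (r-∪-free X∩A≡∅ noCircuitOutsideA⊆X) ⟩
    suc (r (A ∪ X))        ≤⟨ s≤s (r-mono (∪-mono-⊆ id X⊆C)) ⟩
    suc (r (A ∪ C))        ∎
    where
    X : Subset n
    X = C ─ A - e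
    X⊆C─A : X ⊆ C ─ A
    X⊆C─A = p─q⊆p (C ─ A) ⁅ e ⁆
    X⊆C : X ⊆ C
    X⊆C = p─q⊆p C A ∘ X⊆C─A
    X∩A≡∅ : ∀ {x} → x ∈ X → x ∉ A
    X∩A≡∅ = proj₂ ∘ x∈p─q⁻ C A ∘ X⊆C─A
    noCircuitOutsideA⊆X : ∀ C′ → IsCircuit M C′ → Nonempty (C′ ─ A) → ¬ C′ ─ A ⊆ X
    noCircuitOutsideA⊆X C′ isCircuit nonempty C′─A⊆X = lobeMinimal C′ isCircuit nonempty
      ( X⊆C─A ∘ C′─A⊆X
      , e , e∈C─A , λ e∈C′─A → proj₂ (x∈p─q⁻ (C ─ A) ⁅ e ⁆ (C′─A⊆X e∈C′─A)) (x∈⁅x⁆ e))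

  r-∪-lobe : ∀ {A C} → IsCircuit M C → Nonempty (C ─ A) → LobeMinimal A C →
             r (A ∪ C) + 1 ≡ r A + ∣ C ─ A ∣
  r-∪-lobe {A} {C} isCircuit nonempty lobeMinimal =
    trans (+-comm (r (A ∪ C)) 1)
          (≤-antisym (r-∪-circuit-< isCircuit nonempty)
                     (r-∪-minimalLobe-≥ nonempty lobeMinimal))

  circuit⇒lobeMinimal-⊥ : ∀ {C} → IsCircuit M C → LobeMinimal ⊥ C
  circuit⇒lobeMinimal-⊥ {C} (_ , minimal) C′ (dep′ , _) _ C′─⊥⊂C─⊥ =
    dep′ (minimal C′ (subst₂ _⊂_ (p─⊥≡p C′) (p─⊥≡p C) C′─⊥⊂C─⊥))

lemma5p5 : (n : ℕ) (M : Matroid n) (C : ℕ → Subset n) (t : ℕ) →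
    IsCircuitDecomposition M C t →
    ∀ i → suc i ≤ t →
    Matroid.r M (D C (suc i)) + 1 ≡ Matroid.r M (D C i) + ∣ lobe C (suc i) ∣
lemma5p5 n M C t ((circuits , _ , _) , _) 0 1≤t =
  r-∪-lobe M C₁-circuit (subst Nonempty (sym (p─⊥≡p (C 1))) (circuit-nonempty M C₁-circuit))
    (circuit⇒lobeMinimal-⊥ M C₁-circuit)
  where
  C₁-circuit : IsCircuit M (C 1)
  C₁-circuit = circuits 1 ≤-refl 1≤t
lemma5p5 n M C t ((circuits , E1 , E2) , _) (suc i) i+2≤t =
  r-∪-lobe M (circuits (suc (suc i)) (s≤s z≤n) i+2≤t)
    (E1 (suc i) (s≤s z≤n) i+2≤t) (E2 (suc i) (s≤s z≤n) i+2≤t)
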